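{- Let $b,c\in\mathbb{Z}$ and for $n\in\mathbb{N}$ let $T_n(b,c)=\sum_{k=0}^{\lfloor n/2\rfloor}\binom n{2k}\binom{2k}k b^{n-2k}c^k$. For all positive integers $n$, $$2c\sum_{k=0}^{n-1}T_k(b,c^2)(b-2c)^{n-1-k}=-nT_n(b,c^2)+(b+2c)nT_{n-1}(b,c^2).$$ -}

module Defs where

open import Data.Nat as ℕ using (ℕ; zero; suc; _∸_; ⌊_/2⌋)
open import Data.Nat.Combinatorics using (_C_)
open import Data.Integer using (ℤ; +_; _+_; _*_; _^_)

sumTo : ℕ → (ℕ → ℤ) → ℤ
sumTo zero    f = + 0
sumTo (suc n) f = sumTo n f + f n

T : ℕ → ℤ → ℤ → ℤ
T n b c = sumTo (suc ⌊ n /2⌋) λ k →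
  (+ (n C (2 ℕ.* k))) * (+ ((2 ℕ.* k) C k)) * (b ^ (n ∸ 2 ℕ.* k)) * (c ^ k)

-- The proof rests on the three-term recurrence
--   (n+1) T_{n+1}(b,c) = (2n+1) b T_n(b,c) - n (b² - 4c) T_{n-1}(b,c).
-- It is proved coefficientwise: the trinomial coefficients tri n k = C(n,2k)C(2k,k)
-- satisfy a linear recurrence in n (tri-recurrence), derived over ℕ from the absorption
-- identity k·C(n,k) = n·C(n-1,k-1).  Multiplying by the monomials b^(n+1-2k) c^k and
-- summing over k (all sums are padded to a common range, since terms with 2k > n vanish)
-- gives the recurrence for T.  The lemma then follows by induction on n: the partial sums
-- S_n obey S_{n+1} = d S_n + T_n, and the inductive step is the recurrence at c := c²
-- together with the factorisation (b - 2c)(b + 2c) = b² - 4c².  The identity also holds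
-- for n = 0.
module Submission where

open import Defs
open import Data.Nat as ℕ using (ℕ; zero; suc; _∸_; ⌊_/2⌋; z≤n; s≤s)
import Data.Nat.Properties as ℕP
open import Data.Nat.Combinatorics using (_C_; k>n⇒nCk≡0; nCk+nC[k+1]≡[n+1]C[k+1]; nC1≡n; nCk≡nC[n∸k])
import Data.Nat.Tactic.RingSolver as ℕRing
open import Data.Sum using (inj₁; inj₂)
open import Relation.Binary.PropositionalEquality
open import Relation.Nullary using (yes; no)

module Binomial where
  open import Data.Nat using (_+_; _*_; _<_; _≤_)

  absorption : ∀ n j → suc j * (suc n C suc j) ≡ suc n * (n C j)
  absorption zero    zero    = refl
  absorption zero    (suc j) =
    trans (cong (suc (suc j) *_) (k>n⇒nCk≡0 {1} {suc (suc j)} (s≤s (s≤s z≤n)))) (ℕP.*-zeroʳ (suc (suc j)))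
  absorption (suc n) zero    =
    trans (ℕP.*-identityˡ _) (trans (nC1≡n (suc (suc n))) (sym (ℕP.*-identityʳ (suc (suc n)))))
  absorption (suc n) (suc j) = begin
    suc (suc j) * (suc (suc n) C suc (suc j))
      ≡⟨ cong (suc (suc j) *_) (sym (nCk+nC[k+1]≡[n+1]C[k+1] (suc n) (suc j))) ⟩
    suc (suc j) * (a + b)
      ≡⟨ regroup (suc j) a b ⟩
    a + (suc j * a + suc (suc j) * b)
      ≡⟨ cong₂ (λ x y → a + (x + y)) (absorption n j) (absorption n (suc j)) ⟩
    a + (suc n * (n C j) + suc n * (n C suc j))
      ≡⟨ cong (a +_) (sym (ℕP.*-distribˡ-+ (suc n) (n C j) (n C suc j))) ⟩
    a + suc n * (n C j + n C suc j)
      ≡⟨ cong (λ x → a + suc n * x) (nCk+nC[k+1]≡[n+1]C[k+1] n j) ⟩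
    suc (suc n) * a ∎
    where
    open ≡-Reasoning
    a = suc n C suc j
    b = suc n C suc (suc j)
    regroup : ∀ j a b → suc j * (a + b) ≡ a + (j * a + suc j * b)
    regroup = ℕRing.solve-∀

  weighted-pascal : ∀ n j → suc n * (suc n C j) ≡ suc n * (n C j) + j * (suc n C j)
  weighted-pascal n zero    = sym (ℕP.+-identityʳ _)
  weighted-pascal n (suc j) = begin
    suc n * (suc n C suc j)                       ≡⟨ cong (suc n *_) (sym (nCk+nC[k+1]≡[n+1]C[k+1] n j)) ⟩
    suc n * (n C j + n C suc j)                   ≡⟨ ℕP.*-distribˡ-+ (suc n) (n C j) (n C suc j) ⟩
    suc n * (n C j) + suc n * (n C suc j)         ≡⟨ cong (_+ suc n * (n C suc j)) (sym (absorption n j)) ⟩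
    suc j * (suc n C suc j) + suc n * (n C suc j) ≡⟨ ℕP.+-comm (suc j * (suc n C suc j)) _ ⟩
    suc n * (n C suc j) + suc j * (suc n C suc j) ∎
    where open ≡-Reasoning

  double-absorption : ∀ n j → suc (suc j) * suc j * (suc (suc n) C suc (suc j)) ≡ suc (suc n) * suc n * (n C j)
  double-absorption n j = begin
    suc (suc j) * suc j * (suc (suc n) C suc (suc j)) ≡⟨ swap (suc (suc j)) (suc j) (suc (suc n) C suc (suc j)) ⟩
    suc j * (suc (suc j) * (suc (suc n) C suc (suc j))) ≡⟨ cong (suc j *_) (absorption (suc n) (suc j)) ⟩
    suc j * (suc (suc n) * (suc n C suc j))             ≡⟨ swap (suc (suc n)) (suc j) (suc n C suc j) ⟨
    suc (suc n) * suc j * (suc n C suc j)               ≡⟨ ℕP.*-assoc (suc (suc n)) (suc j) _ ⟩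
    suc (suc n) * (suc j * (suc n C suc j))             ≡⟨ cong (suc (suc n) *_) (absorption n j) ⟩
    suc (suc n) * (suc n * (n C j))                     ≡⟨ ℕP.*-assoc (suc (suc n)) (suc n) (n C j) ⟨
    suc (suc n) * suc n * (n C j)                       ∎
    where
    open ≡-Reasoning
    swap : ∀ x y z → x * y * z ≡ y * (x * z)
    swap = ℕRing.solve-∀

  -- 2(i+1) = 2i+2; needed because 2 * suc i does not reduce to that form.
  double-suc : ∀ i → 2 * suc i ≡ suc (suc (2 * i))
  double-suc i = cong suc (ℕP.+-suc i (i + 0))

  -- The central coefficients satisfy  (i+1)²·C(2i+2,i+1) = (2i+2)(2i+1)·C(2i,i);
  -- the middle step uses the symmetry C(2i+1,i) = C(2i+1,i+1).
  central-absorption : ∀ i → suc i * suc i * (suc (suc (2 * i)) C suc i) ≡ suc (suc (2 * i)) * suc (2 * i) * ((2 * i) C i)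
  central-absorption i = begin
    suc i * suc i * (p C suc i)   ≡⟨ ℕP.*-assoc (suc i) (suc i) _ ⟩
    suc i * (suc i * (p C suc i)) ≡⟨ cong (suc i *_) (absorption q i) ⟩
    suc i * (p * (q C i))         ≡⟨ swap (suc i) p (q C i) ⟩
    p * (suc i * (q C i))         ≡⟨ cong (λ x → p * (suc i * x)) middle-symmetry ⟩
    p * (suc i * (q C suc i))     ≡⟨ cong (p *_) (absorption (2 * i) i) ⟩
    p * (q * ((2 * i) C i))       ≡⟨ ℕP.*-assoc p q _ ⟨
    p * q * ((2 * i) C i)         ∎
    where
    open ≡-Reasoning
    p = suc (suc (2 * i))
    q = suc (2 * i)
    swap : ∀ x y z → x * (y * z) ≡ y * (x * z)
    swap = ℕRing.solve-∀
    middle-symmetry : q C i ≡ q C suc i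
    middle-symmetry = trans (nCk≡nC[n∸k] i≤q) (cong (q C_) q∸i≡1+i)
      where
      i≤q : i ≤ q
      i≤q = ℕP.m≤n⇒m≤1+n (ℕP.m≤m+n i (i + 0))
      q∸i≡1+i : q ∸ i ≡ suc i
      q∸i≡1+i = trans (ℕP.+-∸-assoc 1 (ℕP.m≤m+n i (i + 0))) (cong suc (trans (ℕP.m+n∸m≡n i (i + 0)) (ℕP.+-identityʳ i)))

  -- The trinomial coefficient C(n,2k)·C(2k,k) = n!/(k!·k!·(n-2k)!), the coefficient of b^(n-2k)c^k in T_n(b,c).
  tri : ℕ → ℕ → ℕ
  tri n k = (n C (2 * k)) * ((2 * k) C k)

  tri-vanish : ∀ n k → n < 2 * k → tri n k ≡ 0
  tri-vanish n k n<2k = cong (_* ((2 * k) C k)) (k>n⇒nCk≡0 n<2k)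

  tri-step : ∀ n k → suc n * tri (suc n) k ≡ suc n * tri n k + 2 * k * tri (suc n) k
  tri-step n k = begin
    suc n * (X * W)                   ≡⟨ ℕP.*-assoc (suc n) X W ⟨
    suc n * X * W                     ≡⟨ cong (_* W) (weighted-pascal n (2 * k)) ⟩
    (suc n * Y + 2 * k * X) * W       ≡⟨ distribute (suc n) Y (2 * k) X W ⟩
    suc n * (Y * W) + 2 * k * (X * W) ∎
    where
    open ≡-Reasoning
    X = suc n C (2 * k)
    Y = n C (2 * k)
    W = (2 * k) C k
    distribute : ∀ a y b x w → (a * y + b * x) * w ≡ a * (y * w) + b * (x * w)
    distribute = ℕRing.solve-∀

  tri-double-step : ∀ n k → suc k * suc k * tri (suc (suc n)) (suc k) ≡ suc (suc n) * suc n * tri n k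
  tri-double-step n k = ℕP.*-cancelˡ-≡ _ _ (p * q) (begin
    p * q * (suc k * suc k * ((suc (suc n) C (2 * suc k)) * ((2 * suc k) C suc k)))
      ≡⟨ cong (λ j → p * q * (suc k * suc k * ((suc (suc n) C j) * (j C suc k)))) (double-suc k) ⟩
    p * q * (suc k * suc k * ((suc (suc n) C p) * (p C suc k)))
      ≡⟨ regroup p q (suc k) (suc (suc n) C p) (p C suc k) ⟩
    (p * q * (suc (suc n) C p)) * (suc k * suc k * (p C suc k))
      ≡⟨ cong₂ _*_ (double-absorption n (2 * k)) (central-absorption k) ⟩
    (suc (suc n) * suc n * (n C (2 * k))) * (p * q * ((2 * k) C k))
      ≡⟨ regroup′ (suc (suc n) * suc n) (n C (2 * k)) p q ((2 * k) C k) ⟩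
    p * q * (suc (suc n) * suc n * tri n k) ∎)
    where
    open ≡-Reasoning
    p = suc (suc (2 * k))
    q = suc (2 * k)
    regroup : ∀ p q s x w → p * q * (s * s * (x * w)) ≡ (p * q * x) * (s * s * w)
    regroup = ℕRing.solve-∀
    regroup′ : ∀ a z p q w → (a * z) * (p * q * w) ≡ p * q * (a * (z * w))
    regroup′ = ℕRing.solve-∀

  -- tri(n-1,k-1), read as 0 when k = 0; it is the coefficient of b^(n+1-2k)c^k in c·T_{n-1}(b,c).
  tri-shifted : ℕ → ℕ → ℕ
  tri-shifted n zero    = 0
  tri-shifted n (suc k) = tri (n ∸ 1) k

  -- Coefficientwise form of the three-term recurrence of T:
  --   (n+1)·tri(n+1,k) + n·tri(n-1,k) = (2n+1)·tri(n,k) + 4n·tri(n-1,k-1).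
  -- For n, k ≥ 1, n(n+1) times this identity is a linear combination of tri-step (at n and n-1)
  -- and tri-double-step; the ring solver checks the certificate, then n(n+1) is cancelled.
  tri-recurrence : ∀ n k → suc n * tri (suc n) k + n * tri (n ∸ 1) k ≡ suc (2 * n) * tri n k + 4 * n * tri-shifted n k
  tri-recurrence n zero = at-zero n
    where
    at-zero : ∀ n → suc n * 1 + n * 1 ≡ suc (2 * n) * 1 + 4 * n * 0
    at-zero = ℕRing.solve-∀
  tri-recurrence zero (suc k)
    rewrite tri-vanish 1 (suc k) (subst (1 <_) (sym (double-suc k)) (s≤s (s≤s z≤n)))
          | tri-vanish 0 (suc k) (subst (0 <_) (sym (double-suc k)) (s≤s z≤n)) = refl
  tri-recurrence (suc m) (suc i) = ℕP.*-cancelˡ-≡ _ _ (n * suc n) (ℕP.+-cancelʳ-≡ Q₁ _ _ (begin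
    n * suc n * (suc n * X + n * Z) + Q₁               ≡⟨ certificate n k X Y Z V ⟩
    n * suc n * (suc (2 * n) * Y + 4 * n * V) + Q₂     ≡⟨ cong (n * suc n * (suc (2 * n) * Y + 4 * n * V) +_) Q₂≡Q₁ ⟩
    n * suc n * (suc (2 * n) * Y + 4 * n * V) + Q₁     ∎))
    where
    open ≡-Reasoning
    n = suc m
    k = suc i
    X = tri (suc n) k
    Y = tri n k
    Z = tri m k
    V = tri m i
    Q₁ = n * suc n * (n * Y) + 4 * n * (suc n * n * V) + n * (suc n + 2 * k) * (suc n * Y + 2 * k * X)
    Q₂ = n * suc n * (n * Z + 2 * k * Y) + 4 * n * (k * k * X) + n * (suc n + 2 * k) * (suc n * X)
    Q₂≡Q₁ : Q₂ ≡ Q₁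
    Q₂≡Q₁ = cong₂ (λ u w → u + n * (suc n + 2 * k) * w)
              (cong₂ (λ u v → n * suc n * u + 4 * n * v) (sym (tri-step m k)) (tri-double-step m i))
              (tri-step n k)
    certificate : ∀ n k X Y Z V →
      n * suc n * (suc n * X + n * Z)
        + (n * suc n * (n * Y) + 4 * n * (suc n * n * V) + n * (suc n + 2 * k) * (suc n * Y + 2 * k * X))
      ≡ n * suc n * (suc (2 * n) * Y + 4 * n * V)
        + (n * suc n * (n * Z + 2 * k * Y) + 4 * n * (k * k * X) + n * (suc n + 2 * k) * (suc n * X))
    certificate = ℕRing.solve-∀

-- Integer arithmetic is opened only here, so that the operators in Binomial are those of ℕ.
open import Data.Integer using (ℤ; +_; _+_; _-_; _*_; _^_; -_)
import Data.Integer.Properties as ℤP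
open import Data.Integer.Tactic.RingSolver using (solve-∀)

open Binomial using (tri; tri-vanish; tri-shifted; tri-recurrence; double-suc)

sumTo-scale : ∀ N a (f : ℕ → ℤ) → sumTo N (λ k → a * f k) ≡ a * sumTo N f
sumTo-scale zero    a f = sym (ℤP.*-zeroʳ a)
sumTo-scale (suc N) a f =
  trans (cong (_+ a * f N) (sumTo-scale N a f)) (sym (ℤP.*-distribˡ-+ a (sumTo N f) (f N)))

sumTo-linear : ∀ N x y (f g : ℕ → ℤ) →
  sumTo N (λ k → x * f k + y * g k) ≡ x * sumTo N f + y * sumTo N g
sumTo-linear zero    x y f g = empty x y
  where
  empty : ∀ x y → + 0 ≡ x * + 0 + y * + 0
  empty = solve-∀
sumTo-linear (suc N) x y f g =
  trans (cong (_+ (x * f N + y * g N)) (sumTo-linear N x y f g)) (regroup x y (sumTo N f) (sumTo N g) (f N) (g N))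
  where
  regroup : ∀ x y F G u v → x * F + y * G + (x * u + y * v) ≡ x * (F + u) + y * (G + v)
  regroup = solve-∀

sumTo-cong< : ∀ N (f g : ℕ → ℤ) → (∀ k → k ℕ.< N → f k ≡ g k) → sumTo N f ≡ sumTo N g
sumTo-cong< zero    f g f≗g = refl
sumTo-cong< (suc N) f g f≗g =
  cong₂ _+_ (sumTo-cong< N f g (λ k k<N → f≗g k (ℕP.m<n⇒m<1+n k<N))) (f≗g N (ℕP.n<1+n N))

sumTo-split-first : ∀ N (f : ℕ → ℤ) → sumTo (suc N) f ≡ f 0 + sumTo N (λ k → f (suc k))
sumTo-split-first zero    f = trans (ℤP.+-identityˡ (f 0)) (sym (ℤP.+-identityʳ (f 0)))
sumTo-split-first (suc N) f =
  trans (cong (_+ f (suc N)) (sumTo-split-first N f)) (ℤP.+-assoc (f 0) _ (f (suc N)))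

sumTo-truncate : ∀ M N (f : ℕ → ℤ) → M ℕ.≤ N → (∀ k → M ℕ.≤ k → f k ≡ + 0) → sumTo N f ≡ sumTo M f
sumTo-truncate M zero    f z≤n     vanish = refl
sumTo-truncate M (suc N) f M≤1+N vanish with ℕP.m≤n⇒m<n∨m≡n M≤1+N
... | inj₁ (s≤s M≤N) =
  trans (cong₂ _+_ (sumTo-truncate M N f M≤N vanish) (vanish N M≤N)) (ℤP.+-identityʳ (sumTo M f))
... | inj₂ refl = refl

n<2[1+⌊n/2⌋] : ∀ n → n ℕ.< 2 ℕ.* suc ⌊ n /2⌋
n<2[1+⌊n/2⌋] zero          = s≤s z≤n
n<2[1+⌊n/2⌋] (suc zero)    = s≤s (s≤s z≤n)
n<2[1+⌊n/2⌋] (suc (suc n)) =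
  subst (suc (suc n) ℕ.<_) (sym (double-suc (suc ⌊ n /2⌋))) (s≤s (s≤s (n<2[1+⌊n/2⌋] n)))

module Recurrence (b c : ℤ) where

  term : ℕ → ℕ → ℤ
  term n k = (+ (n C (2 ℕ.* k))) * (+ ((2 ℕ.* k) C k)) * (b ^ (n ∸ 2 ℕ.* k)) * (c ^ k)

  monomial : ℕ → ℕ → ℤ
  monomial n k = b ^ (n ∸ 2 ℕ.* k) * c ^ k

  term≡tri : ∀ n k → term n k ≡ + tri n k * monomial n k
  term≡tri n k = trans
    (cong (λ x → x * b ^ (n ∸ 2 ℕ.* k) * c ^ k) (sym (ℤP.pos-* (n C (2 ℕ.* k)) ((2 ℕ.* k) C k))))
    (ℤP.*-assoc (+ tri n k) (b ^ (n ∸ 2 ℕ.* k)) (c ^ k))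

  T-as-sum : ∀ n N → n ℕ.< N → sumTo N (term n) ≡ T n b c
  T-as-sum n N n<N = sumTo-truncate (suc ⌊ n /2⌋) N (term n)
    (ℕP.<-≤-trans (s≤s (ℕP.⌊n/2⌋≤n n)) n<N)
    (λ k 1+⌊n/2⌋≤k → vanish k (ℕP.<-≤-trans (n<2[1+⌊n/2⌋] n) (ℕP.*-monoʳ-≤ 2 1+⌊n/2⌋≤k)))
    where
    vanish : ∀ k → n ℕ.< 2 ℕ.* k → term n k ≡ + 0
    vanish k n<2k = trans (term≡tri n k)
      (trans (cong (λ x → + x * monomial n k) (tri-vanish n k n<2k)) (ℤP.*-zeroˡ (monomial n k)))

  -- Multiplying a summand by b^j raises the exponent of b by j; this needs no
  -- assumption 2k ≤ n, because otherwise the coefficient is 0.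
  raise-b : ∀ j n k → b ^ j * term n k ≡ + tri n k * monomial (j ℕ.+ n) k
  raise-b j n k with 2 ℕ.* k ℕP.≤? n
  ... | yes 2k≤n = begin
    b ^ j * term n k                                          ≡⟨ cong (b ^ j *_) (term≡tri n k) ⟩
    b ^ j * (+ tri n k * (b ^ (n ∸ 2 ℕ.* k) * c ^ k))         ≡⟨ regroup (b ^ j) (+ tri n k) _ (c ^ k) ⟩
    + tri n k * (b ^ j * b ^ (n ∸ 2 ℕ.* k) * c ^ k)           ≡⟨ cong (λ x → + tri n k * (x * c ^ k)) (sym (ℤP.^-distribˡ-+-* b j _)) ⟩
    + tri n k * (b ^ (j ℕ.+ (n ∸ 2 ℕ.* k)) * c ^ k)           ≡⟨ cong (λ e → + tri n k * (b ^ e * c ^ k)) (sym (ℕP.+-∸-assoc j 2k≤n)) ⟩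
    + tri n k * monomial (j ℕ.+ n) k                          ∎
    where
    open ≡-Reasoning
    regroup : ∀ x a y z → x * (a * (y * z)) ≡ a * (x * y * z)
    regroup = solve-∀
  ... | no 2k≰n = begin
    b ^ j * term n k                       ≡⟨ cong (b ^ j *_) (term≡tri n k) ⟩
    b ^ j * (+ tri n k * monomial n k)     ≡⟨ cong (λ x → b ^ j * (+ x * monomial n k)) tri≡0 ⟩
    b ^ j * (+ 0 * monomial n k)           ≡⟨ both-zero (b ^ j) (monomial n k) (monomial (j ℕ.+ n) k) ⟩
    + 0 * monomial (j ℕ.+ n) k             ≡⟨ cong (λ x → + x * monomial (j ℕ.+ n) k) tri≡0 ⟨
    + tri n k * monomial (j ℕ.+ n) k       ∎
    where
    open ≡-Reasoning
    tri≡0 : tri n k ≡ 0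
    tri≡0 = tri-vanish n k (ℕP.≰⇒> 2k≰n)
    both-zero : ∀ x y z → x * (+ 0 * y) ≡ + 0 * z
    both-zero = solve-∀

  -- The summand of c·T_{n-1} moved from index k to index k+1 (and 0 at index 0), so that
  -- it carries the monomial b^(n+1-2(k+1)) c^(k+1) matching the other summands.
  shifted : ℕ → ℕ → ℤ
  shifted n zero    = + 0
  shifted n (suc k) = c * term (n ∸ 1) k

  shifted≡tri : ∀ n k → shifted n k ≡ + tri-shifted n k * monomial (suc n) k
  shifted≡tri n zero    = sym (ℤP.*-zeroˡ (monomial (suc n) zero))
  shifted≡tri n (suc k) = begin
    c * term (n ∸ 1) k                                            ≡⟨ cong (c *_) (term≡tri (n ∸ 1) k) ⟩
    c * (+ tri (n ∸ 1) k * (b ^ (n ∸ 1 ∸ 2 ℕ.* k) * c ^ k))       ≡⟨ regroup c (+ tri (n ∸ 1) k) (b ^ (n ∸ 1 ∸ 2 ℕ.* k)) (c ^ k) ⟩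
    + tri (n ∸ 1) k * (b ^ (n ∸ 1 ∸ 2 ℕ.* k) * (c * c ^ k))       ≡⟨ cong (λ e → + tri (n ∸ 1) k * (b ^ e * c ^ suc k)) exponent ⟩
    + tri (n ∸ 1) k * monomial (suc n) (suc k)                     ∎
    where
    open ≡-Reasoning
    regroup : ∀ x a y z → x * (a * (y * z)) ≡ a * (y * (x * z))
    regroup = solve-∀
    exponent : n ∸ 1 ∸ 2 ℕ.* k ≡ suc n ∸ 2 ℕ.* suc k
    exponent = trans (ℕP.∸-+-assoc n 1 (2 ℕ.* k)) (cong (suc n ∸_) (sym (double-suc k)))

  cast-scale : ∀ a x m → + a * (+ x * m) ≡ + (a ℕ.* x) * m
  cast-scale a x m = trans (sym (ℤP.*-assoc (+ a) (+ x) m)) (cong (_* m) (sym (ℤP.pos-* a x)))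

  cast-add : ∀ x y m → + x * m + + y * m ≡ + (x ℕ.+ y) * m
  cast-add x y m = trans (sym (ℤP.*-distribʳ-+ m (+ x) (+ y))) (cong (_* m) (sym (ℤP.pos-+ x y)))

  -- The recurrence at the level of summands: all four terms are natural multiples of the
  -- monomial b^(n+1-2k) c^k, and the multiples satisfy tri-recurrence.
  termwise : ∀ n k → (+ suc n) * term (suc n) k + (+ n * (b * b)) * term (n ∸ 1) k
                   ≡ (+ suc (2 ℕ.* n) * b) * term n k + (+ (4 ℕ.* n)) * shifted n k
  termwise n k = begin
    (+ suc n) * term (suc n) k + (+ n * (b * b)) * term (n ∸ 1) k
      ≡⟨ cong₂ _+_ leading (trailing n) ⟩
    + (suc n ℕ.* tri (suc n) k) * M + + (n ℕ.* tri (n ∸ 1) k) * M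
      ≡⟨ cast-add (suc n ℕ.* tri (suc n) k) (n ℕ.* tri (n ∸ 1) k) M ⟩
    + (suc n ℕ.* tri (suc n) k ℕ.+ n ℕ.* tri (n ∸ 1) k) * M
      ≡⟨ cong (λ x → + x * M) (tri-recurrence n k) ⟩
    + (suc (2 ℕ.* n) ℕ.* tri n k ℕ.+ 4 ℕ.* n ℕ.* tri-shifted n k) * M
      ≡⟨ cast-add (suc (2 ℕ.* n) ℕ.* tri n k) (4 ℕ.* n ℕ.* tri-shifted n k) M ⟨
    + (suc (2 ℕ.* n) ℕ.* tri n k) * M + + (4 ℕ.* n ℕ.* tri-shifted n k) * M
      ≡⟨ cong₂ _+_ middle shift ⟨
    (+ suc (2 ℕ.* n) * b) * term n k + (+ (4 ℕ.* n)) * shifted n k ∎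
    where
    open ≡-Reasoning
    M = monomial (suc n) k
    leading : (+ suc n) * term (suc n) k ≡ + (suc n ℕ.* tri (suc n) k) * M
    leading = trans (cong (+ suc n *_) (term≡tri (suc n) k)) (cast-scale (suc n) (tri (suc n) k) M)
    trailing : ∀ n → (+ n * (b * b)) * term (n ∸ 1) k ≡ + (n ℕ.* tri (n ∸ 1) k) * monomial (suc n) k
    trailing zero    = vanishing (b * b) (term 0 k) (monomial 1 k)
      where
      vanishing : ∀ x y z → (+ 0 * x) * y ≡ + 0 * z
      vanishing = solve-∀
    trailing (suc m) = begin
      (+ suc m * (b * b)) * term m k          ≡⟨ ℤP.*-assoc (+ suc m) (b * b) (term m k) ⟩
      + suc m * (b * b * term m k)            ≡⟨ cong (λ x → + suc m * (b * x * term m k)) (ℤP.^-identityʳ b) ⟨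
      + suc m * (b ^ 2 * term m k)            ≡⟨ cong (+ suc m *_) (raise-b 2 m k) ⟩
      + suc m * (+ tri m k * monomial (2 ℕ.+ m) k) ≡⟨ cast-scale (suc m) (tri m k) (monomial (2 ℕ.+ m) k) ⟩
      + (suc m ℕ.* tri m k) * monomial (suc (suc m)) k ∎
    middle : (+ suc (2 ℕ.* n) * b) * term n k ≡ + (suc (2 ℕ.* n) ℕ.* tri n k) * M
    middle = begin
      (+ suc (2 ℕ.* n) * b) * term n k        ≡⟨ ℤP.*-assoc (+ suc (2 ℕ.* n)) b (term n k) ⟩
      + suc (2 ℕ.* n) * (b * term n k)        ≡⟨ cong (λ x → + suc (2 ℕ.* n) * (x * term n k)) (ℤP.^-identityʳ b) ⟨
      + suc (2 ℕ.* n) * (b ^ 1 * term n k)    ≡⟨ cong (+ suc (2 ℕ.* n) *_) (raise-b 1 n k) ⟩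
      + suc (2 ℕ.* n) * (+ tri n k * M)       ≡⟨ cast-scale (suc (2 ℕ.* n)) (tri n k) M ⟩
      + (suc (2 ℕ.* n) ℕ.* tri n k) * M       ∎
    shift : (+ (4 ℕ.* n)) * shifted n k ≡ + (4 ℕ.* n ℕ.* tri-shifted n k) * M
    shift = trans (cong (+ (4 ℕ.* n) *_) (shifted≡tri n k)) (cast-scale (4 ℕ.* n) (tri-shifted n k) M)

  -- Summing termwise over k < n+2 (long enough for T_{n+1}, T_n and T_{n-1}).
  recurrence⁺ : ∀ n → (+ suc n) * T (suc n) b c + (+ n * (b * b)) * T (n ∸ 1) b c
                    ≡ (+ suc (2 ℕ.* n) * b) * T n b c + (+ (4 ℕ.* n)) * (c * T (n ∸ 1) b c)
  recurrence⁺ n = begin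
    (+ suc n) * T (suc n) b c + (+ n * (b * b)) * T (n ∸ 1) b c
      ≡⟨ cong₂ (λ u v → (+ suc n) * u + (+ n * (b * b)) * v)
               (T-as-sum (suc n) N (ℕP.n<1+n (suc n))) (T-as-sum (n ∸ 1) N n∸1<N) ⟨
    (+ suc n) * sumTo N (term (suc n)) + (+ n * (b * b)) * sumTo N (term (n ∸ 1))
      ≡⟨ sumTo-linear N (+ suc n) (+ n * (b * b)) (term (suc n)) (term (n ∸ 1)) ⟨
    sumTo N (λ k → (+ suc n) * term (suc n) k + (+ n * (b * b)) * term (n ∸ 1) k)
      ≡⟨ sumTo-cong< N _ _ (λ k _ → termwise n k) ⟩
    sumTo N (λ k → (+ suc (2 ℕ.* n) * b) * term n k + (+ (4 ℕ.* n)) * shifted n k)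
      ≡⟨ sumTo-linear N (+ suc (2 ℕ.* n) * b) (+ (4 ℕ.* n)) (term n) (shifted n) ⟩
    (+ suc (2 ℕ.* n) * b) * sumTo N (term n) + (+ (4 ℕ.* n)) * sumTo N (shifted n)
      ≡⟨ cong₂ (λ u v → (+ suc (2 ℕ.* n) * b) * u + (+ (4 ℕ.* n)) * v)
               (T-as-sum n N (ℕP.m<n⇒m<1+n (ℕP.n<1+n n))) shifted-sum ⟩
    (+ suc (2 ℕ.* n) * b) * T n b c + (+ (4 ℕ.* n)) * (c * T (n ∸ 1) b c) ∎
    where
    open ≡-Reasoning
    N = suc (suc n)
    n∸1<N : n ∸ 1 ℕ.< N
    n∸1<N = s≤s (ℕP.m≤n⇒m≤1+n (ℕP.m∸n≤m n 1))
    shifted-sum : sumTo N (shifted n) ≡ c * T (n ∸ 1) b c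
    shifted-sum = begin
      sumTo N (shifted n)                          ≡⟨ sumTo-split-first (suc n) (shifted n) ⟩
      + 0 + sumTo (suc n) (λ k → c * term (n ∸ 1) k) ≡⟨ ℤP.+-identityˡ (sumTo (suc n) (λ k → c * term (n ∸ 1) k)) ⟩
      sumTo (suc n) (λ k → c * term (n ∸ 1) k)     ≡⟨ sumTo-scale (suc n) c (term (n ∸ 1)) ⟩
      c * sumTo (suc n) (term (n ∸ 1))             ≡⟨ cong (c *_) (T-as-sum (n ∸ 1) (suc n) (s≤s (ℕP.m∸n≤m n 1))) ⟩
      c * T (n ∸ 1) b c                            ∎

  three-term-recurrence : ∀ n → (+ 1 + + n) * T (suc n) b c
    ≡ (+ 1 + + 2 * + n) * b * T n b c - + n * (b * b - + 4 * c) * T (n ∸ 1) b c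
  three-term-recurrence n = begin
    (+ 1 + + n) * T₊                                                   ≡⟨ cong (_* T₊) (ℤP.pos-+ 1 n) ⟨
    (+ suc n) * T₊                                                     ≡⟨ isolate ((+ suc n) * T₊) ((+ n * (b * b)) * T₋) ⟩
    (+ suc n) * T₊ + (+ n * (b * b)) * T₋ - (+ n * (b * b)) * T₋       ≡⟨ cong (_- (+ n * (b * b)) * T₋) (recurrence⁺ n) ⟩
    (+ suc (2 ℕ.* n) * b) * T₀ + (+ (4 ℕ.* n)) * (c * T₋) - (+ n * (b * b)) * T₋
      ≡⟨ cong₂ (λ u v → (u * b) * T₀ + v * (c * T₋) - (+ n * (b * b)) * T₋) odd (ℤP.pos-* 4 n) ⟩
    (+ 1 + + 2 * + n) * b * T₀ + (+ 4 * + n) * (c * T₋) - (+ n * (b * b)) * T₋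
      ≡⟨ collect b c (+ n) T₀ T₋ ⟩
    (+ 1 + + 2 * + n) * b * T₀ - + n * (b * b - + 4 * c) * T₋          ∎
    where
    open ≡-Reasoning
    T₊ = T (suc n) b c
    T₀ = T n b c
    T₋ = T (n ∸ 1) b c
    odd : + suc (2 ℕ.* n) ≡ + 1 + + 2 * + n
    odd = trans (ℤP.pos-+ 1 (2 ℕ.* n)) (cong (λ x → + 1 + x) (ℤP.pos-* 2 n))
    isolate : ∀ x y → x ≡ x + y - y
    isolate = solve-∀
    collect : ∀ b c N T₀ T₋ → (+ 1 + + 2 * N) * b * T₀ + (+ 4 * N) * (c * T₋) - (N * (b * b)) * T₋
                             ≡ (+ 1 + + 2 * N) * b * T₀ - N * (b * b - + 4 * c) * T₋
    collect = solve-∀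

module PartialSums (b c : ℤ) where

  d : ℤ
  d = b - + 2 * c

  S : ℕ → ℤ
  S n = sumTo n (λ k → T k b (c ^ 2) * d ^ (n ∸ 1 ∸ k))

  S-step : ∀ n → S (suc n) ≡ d * S n + T n b (c ^ 2)
  S-step n = cong₂ _+_
    (trans (sumTo-cong< n _ _ one-more-d) (sumTo-scale n d (λ k → T k b (c ^ 2) * d ^ (n ∸ 1 ∸ k))))
    (trans (cong (λ e → T n b (c ^ 2) * d ^ e) (ℕP.n∸n≡0 n)) (ℤP.*-identityʳ (T n b (c ^ 2))))
    where
    one-more-d : ∀ k → k ℕ.< n → T k b (c ^ 2) * d ^ (n ∸ k) ≡ d * (T k b (c ^ 2) * d ^ (n ∸ 1 ∸ k))
    one-more-d k (s≤s k≤m) =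
      trans (cong (λ e → T k b (c ^ 2) * d ^ e) (ℕP.+-∸-assoc 1 k≤m)) (swap (T k b (c ^ 2)) d _)
      where
      swap : ∀ x y z → x * (y * z) ≡ y * (x * z)
      swap = solve-∀

  partial-sum-identity : ∀ n →
    + 2 * c * S n ≡ - (+ n * T n b (c ^ 2)) + (b + + 2 * c) * + n * T (n ∸ 1) b (c ^ 2)
  partial-sum-identity zero    = empty b c (T 0 b (c ^ 2))
    where
    empty : ∀ b c t → + 2 * c * + 0 ≡ - (+ 0 * t) + (b + + 2 * c) * + 0 * t
    empty = solve-∀
  partial-sum-identity (suc n) = begin
    + 2 * c * S (suc n)                                   ≡⟨ cong (+ 2 * c *_) (S-step n) ⟩
    + 2 * c * (d * S n + T₀)                              ≡⟨ distribute (+ 2 * c) d (S n) T₀ ⟩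
    d * (+ 2 * c * S n) + + 2 * c * T₀                    ≡⟨ cong (λ u → d * u + + 2 * c * T₀) (partial-sum-identity n) ⟩
    d * (- (+ n * T₀) + (b + + 2 * c) * + n * T₋) + + 2 * c * T₀
      ≡⟨ rearrange b c (+ n) T₀ T₋ ⟩
    - ((+ 1 + + 2 * + n) * b * T₀ - + n * (b * b - + 4 * (c * c)) * T₋) + (b + + 2 * c) * (+ 1 + + n) * T₀
      ≡⟨ cong (λ u → - u + (b + + 2 * c) * (+ 1 + + n) * T₀) recurrence ⟨
    - ((+ 1 + + n) * T₊) + (b + + 2 * c) * (+ 1 + + n) * T₀
      ≡⟨ cong (λ v → - (v * T₊) + (b + + 2 * c) * v * T₀) (ℤP.pos-+ 1 n) ⟨
    - (+ suc n * T₊) + (b + + 2 * c) * + suc n * T₀       ∎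
    where
    open ≡-Reasoning
    open Recurrence b (c ^ 2) using (three-term-recurrence)
    T₊ = T (suc n) b (c ^ 2)
    T₀ = T n b (c ^ 2)
    T₋ = T (n ∸ 1) b (c ^ 2)
    -- The recurrence at c := c², where b² - 4c² = (b - 2c)(b + 2c).
    recurrence : (+ 1 + + n) * T₊ ≡ (+ 1 + + 2 * + n) * b * T₀ - + n * (b * b - + 4 * (c * c)) * T₋
    recurrence = trans (three-term-recurrence n)
      (cong (λ s → (+ 1 + + 2 * + n) * b * T₀ - + n * (b * b - + 4 * s) * T₋) (cong (c *_) (ℤP.^-identityʳ c)))
    distribute : ∀ x y s t → x * (y * s + t) ≡ y * (x * s) + x * t
    distribute = solve-∀
    rearrange : ∀ b c N T₀ T₋ →
      (b - + 2 * c) * (- (N * T₀) + (b + + 2 * c) * N * T₋) + + 2 * c * T₀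
        ≡ - ((+ 1 + + 2 * N) * b * T₀ - N * (b * b - + 4 * (c * c)) * T₋) + (b + + 2 * c) * (+ 1 + N) * T₀
    rearrange = solve-∀

lemma3p1 : (b c : ℤ) (n : ℕ) → ℕ.NonZero n →
    (+ 2) * c * sumTo n (λ k → T k b (c ^ 2) * ((b - (+ 2) * c) ^ (n ∸ 1 ∸ k)))
      ≡ - ((+ n) * T n b (c ^ 2)) + (b + (+ 2) * c) * (+ n) * T (n ∸ 1) b (c ^ 2)
lemma3p1 b c n _ = PartialSums.partial-sum-identity b c n
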